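{- Let $m,n,k,p$ be positive integers with $p\ge 2$ and $1\le k<p$, and let $A$ be an $(mp+1)\times np$ array of nonnegative integers. Let $a_1,\dots,a_k$ be the first $k$ entries and $b_{k+1},\dots,b_p$ the last $p-k$ entries (in order) of the top row of $A$, and let $c_1,\dots,c_k$ be the first $k$ entries and $d_{k+1},\dots,d_p$ the last $p-k$ entries (in order) of the bottom row of $A$. Suppose that all $p\times p$ subarrays of $A$ formed from $p$ consecutive rows and $p$ consecutive columns have the same sum. Then $\sum_{i=1}^k a_i+\sum_{j=1}^{p-k}b_{k+j}=\sum_{i=1}^k c_i+\sum_{j=1}^{p-k}d_{k+j}$. -}

module Defs where

open import Data.Nat using (ℕ; zero; suc; _+_; _*_; _∸_; _≤_; _<_)
open import Data.Nat.Properties using (≤-trans; ≤-reflexive; m∸n+n≡m)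
open import Data.Fin using (Fin; toℕ; fromℕ<)
open import Data.Fin.Properties using (toℕ<n)
open import Data.Nat.Properties using (+-monoʳ-<)
open import Relation.Binary.PropositionalEquality using (_≡_)

Array : ℕ → ℕ → Set
Array r c = Fin r → Fin c → ℕ

sumTo : (len : ℕ) → (Fin len → ℕ) → ℕ
sumTo zero    f = 0
sumTo (suc l) f = sumTo l (λ t → f (Data.Fin.inject₁ t)) + f (Data.Fin.fromℕ l)

shift : {N len : ℕ} (s : ℕ) → s + len ≤ N → Fin len → Fin N
shift {N} {len} s le t = fromℕ< (≤-trans (+-monoʳ-< s (toℕ<n t)) le)

blockSum : {R C : ℕ} → Array R C → (p i j : ℕ) → i + p ≤ R → j + p ≤ C → ℕ
blockSum A p i j hi hj =
  sumTo p (λ s → sumTo p (λ t → A (shift i hi s) (shift j hj t)))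

AllBlocksEqual : {R C : ℕ} → Array R C → ℕ → Set
AllBlocksEqual {R} {C} A p =
  ∀ i j i' j' (hi : i + p ≤ R) (hj : j + p ≤ C) (hi' : i' + p ≤ R) (hj' : j' + p ≤ C) →
  blockSum A p i j hi hj ≡ blockSum A p i' j' hi' hj'

rowPrefixSum : {C : ℕ} → (Fin C → ℕ) → (len : ℕ) → len ≤ C → ℕ
rowPrefixSum row len le = sumTo len (λ t → row (shift 0 le t))

rowSuffixSum : {C : ℕ} → (Fin C → ℕ) → (len : ℕ) → len ≤ C → ℕ
rowSuffixSum {C} row len le = sumTo len (λ t → row (shift (C ∸ len) (≤-reflexive (m∸n+n≡m le)) t))

-- Sliding a p × p block one column to the right adds one column segment of
-- height p and removes another, so equal block sums make every such segment
-- periodic in the column index with period p.  Hence the last p − k entries of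
-- each row may be replaced, inside any window of p consecutive rows, by entries
-- k, …, p − 1, and the window sum of the row quantity f(i) = (first k entries)
-- + (last p − k entries) becomes a block sum.  Equal block sums now make f
-- periodic in the row index with period p, and rows 0 and mp are mp apart.
module Submission where

open import Defs
open import Data.Nat using (ℕ; zero; suc; _+_; _*_; _∸_; _≤_; _<_; _≥_; z≤n; s≤s; _<?_)
open import Data.Nat.Properties
open import Algebra.Properties.CommutativeSemigroup +-commutativeSemigroup using (interchange)
open import Data.Fin using (Fin; zero; fromℕ; toℕ; fromℕ<; inject₁)
open import Data.Fin.Properties using (toℕ-fromℕ; fromℕ<-toℕ; toℕ-fromℕ<; toℕ-inject₁; toℕ<n)
open import Data.Empty using (⊥-elim)
open import Relation.Nullary using (yes; no)
open import Relation.Binary.PropositionalEquality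
open ≡-Reasoning

sum< : ℕ → (ℕ → ℕ) → ℕ
sum< zero    g = 0
sum< (suc l) g = sum< l g + g l

sum<-cong< : ∀ l {g h : ℕ → ℕ} → (∀ t → t < l → g t ≡ h t) → sum< l g ≡ sum< l h
sum<-cong< zero    e = refl
sum<-cong< (suc l) e = cong₂ _+_ (sum<-cong< l (λ t t<l → e t (m<n⇒m<1+n t<l))) (e l ≤-refl)

sum<-cong : ∀ l {g h : ℕ → ℕ} → (∀ t → g t ≡ h t) → sum< l g ≡ sum< l h
sum<-cong l e = sum<-cong< l (λ t _ → e t)

sum<-zero : ∀ l → sum< l (λ _ → 0) ≡ 0
sum<-zero zero    = refl
sum<-zero (suc l) = trans (+-identityʳ _) (sum<-zero l)

sum<-distrib-+ : ∀ l (g h : ℕ → ℕ) → sum< l (λ t → g t + h t) ≡ sum< l g + sum< l h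
sum<-distrib-+ zero    g h = refl
sum<-distrib-+ (suc l) g h =
  trans (cong (_+ (g l + h l)) (sum<-distrib-+ l g h)) (interchange (sum< l g) (sum< l h) (g l) (h l))

sum<-comm : ∀ a b (g : ℕ → ℕ → ℕ) →
  sum< a (λ s → sum< b (g s)) ≡ sum< b (λ t → sum< a (λ s → g s t))
sum<-comm zero    b g = sym (sum<-zero b)
sum<-comm (suc a) b g = trans (cong (_+ sum< b (g a)) (sum<-comm a b g))
  (sym (sum<-distrib-+ b (λ t → sum< a (λ s → g s t)) (g a)))

sum<-suc : ∀ l (g : ℕ → ℕ) → sum< (suc l) g ≡ g 0 + sum< l (λ t → g (suc t))
sum<-suc zero    g = +-comm 0 (g 0)
sum<-suc (suc l) g = trans (cong (_+ g (suc l)) (sum<-suc l g)) (+-assoc (g 0) _ _)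

sum<-+ : ∀ a b (g : ℕ → ℕ) → sum< (a + b) g ≡ sum< a g + sum< b (λ t → g (a + t))
sum<-+ a zero    g rewrite +-identityʳ a = sym (+-identityʳ _)
sum<-+ a (suc b) g rewrite +-suc a b =
  trans (cong (_+ g (a + b)) (sum<-+ a b g)) (+-assoc (sum< a g) _ _)

sumTo≡sum< : ∀ l (g : Fin l → ℕ) (h : ℕ → ℕ) → (∀ t → g t ≡ h (toℕ t)) → sumTo l g ≡ sum< l h
sumTo≡sum< zero    g h e = refl
sumTo≡sum< (suc l) g h e = cong₂ _+_
  (sumTo≡sum< l _ h (λ t → trans (e (inject₁ t)) (cong h (toℕ-inject₁ t))))
  (trans (e (fromℕ l)) (cong h (toℕ-fromℕ l)))

window : ℕ → (ℕ → ℕ) → ℕ → ℕ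
window p g j = sum< p (λ t → g (j + t))

window-slide : ∀ p (g : ℕ → ℕ) j → window p g j + g (j + p) ≡ g j + window p g (suc j)
window-slide p g j = begin
  sum< (suc p) (λ t → g (j + t))            ≡⟨ sum<-suc p _ ⟩
  g (j + 0) + sum< p (λ t → g (j + suc t))  ≡⟨ cong₂ _+_ (cong g (+-identityʳ j))
                                                 (sum<-cong p (λ t → cong g (+-suc j t))) ⟩
  g j + window p g (suc j)                  ∎

window-step⇒≡ : ∀ p (g : ℕ → ℕ) j → window p g j ≡ window p g (suc j) → g j ≡ g (j + p)
window-step⇒≡ p g j eq = sym (+-cancelˡ-≡ (window p g j) _ _ (begin
  window p g j + g (j + p)  ≡⟨ window-slide p g j ⟩
  g j + window p g (suc j)  ≡⟨ cong (g j +_) (sym eq) ⟩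
  g j + window p g j        ≡⟨ +-comm (g j) _ ⟩
  window p g j + g j        ∎))

window-invariant⇒periodic : ∀ N p (g : ℕ → ℕ) →
  (∀ j → suc j + p ≤ N → window p g j ≡ window p g (suc j)) →
  ∀ q j → j + q * p < N → g j ≡ g (j + q * p)
window-invariant⇒periodic N p g inv zero    j _ = cong g (sym (+-identityʳ j))
window-invariant⇒periodic N p g inv (suc q) j h = begin
  g j                ≡⟨ window-step⇒≡ p g j (inv j (≤-trans (s≤s (+-monoʳ-≤ j (m≤m+n p _))) h)) ⟩
  g (j + p)          ≡⟨ window-invariant⇒periodic N p g inv q (j + p)
                          (subst (_< N) (sym (+-assoc j p _)) h) ⟩
  g (j + p + q * p)  ≡⟨ cong g (+-assoc j p _) ⟩
  g (j + suc q * p)  ∎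

-- The last p ∸ k places of [0, p + n' p) start at k + n' p.
prefix+suffix≡sum< : ∀ p k n' (g : ℕ → ℕ) → k ≤ p → (∀ j → j < p → g j ≡ g (j + n' * p)) →
  sum< k g + sum< (p ∸ k) (λ t → g (p + n' * p ∸ (p ∸ k) + t)) ≡ sum< p g
prefix+suffix≡sum< p k n' g k≤p periodic = begin
  sum< k g + sum< (p ∸ k) (λ t → g (p + n' * p ∸ (p ∸ k) + t))
    ≡⟨ cong (sum< k g +_) (sum<-cong< (p ∸ k) (λ t t<p∸k →
         trans (cong g (suffix-start t)) (sym (periodic (k + t) (in-period t t<p∸k))))) ⟩
  sum< k g + sum< (p ∸ k) (λ t → g (k + t))  ≡⟨ sym (sum<-+ k (p ∸ k) g) ⟩
  sum< (k + (p ∸ k)) g                       ≡⟨ cong (λ l → sum< l g) (m+[n∸m]≡n k≤p) ⟩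
  sum< p g                                   ∎
  where
  suffix-start : ∀ t → p + n' * p ∸ (p ∸ k) + t ≡ k + t + n' * p
  suffix-start t = begin
    p + n' * p ∸ (p ∸ k) + t    ≡⟨ cong (_+ t) (+-∸-comm (n' * p) (m∸n≤m p k)) ⟩
    p ∸ (p ∸ k) + n' * p + t    ≡⟨ cong (λ x → x + n' * p + t) (m∸[m∸n]≡n k≤p) ⟩
    k + n' * p + t              ≡⟨ +-assoc k _ t ⟩
    k + (n' * p + t)            ≡⟨ cong (k +_) (+-comm _ t) ⟩
    k + (t + n' * p)            ≡⟨ sym (+-assoc k t _) ⟩
    k + t + n' * p              ∎
  in-period : ∀ t → t < p ∸ k → k + t < p
  in-period t t<p∸k = ≤-trans (≤-reflexive (sym (+-suc k t)))
    (≤-trans (+-monoʳ-≤ k t<p∸k) (≤-reflexive (m+[n∸m]≡n k≤p)))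

block : (ℕ → ℕ → ℕ) → ℕ → ℕ → ℕ → ℕ
block F p i j = sum< p (λ s → sum< p (λ t → F (i + s) (j + t)))

columnSum : (ℕ → ℕ → ℕ) → ℕ → ℕ → ℕ → ℕ
columnSum F p i j = sum< p (λ s → F (i + s) j)

block≡window-columnSum : ∀ F p i j → block F p i j ≡ window p (columnSum F p i) j
block≡window-columnSum F p i j = sum<-comm p p (λ s t → F (i + s) (j + t))

module EqualBlocks (F : ℕ → ℕ → ℕ) (p R n' : ℕ)
  (equal : ∀ i j i' j' → i + p ≤ R → j + p ≤ p + n' * p → i' + p ≤ R → j' + p ≤ p + n' * p →
           block F p i j ≡ block F p i' j') where

  C : ℕ
  C = p + n' * p

  rowEnds : ℕ → ℕ → ℕ
  rowEnds k i = sum< k (F i) + sum< (p ∸ k) (λ t → F i (C ∸ (p ∸ k) + t))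

  columnSum-periodic : ∀ i → i + p ≤ R → ∀ j → j < p → columnSum F p i j ≡ columnSum F p i (j + n' * p)
  columnSum-periodic i hi j j<p = window-invariant⇒periodic C p (columnSum F p i)
    (λ j' h → begin
      window p (columnSum F p i) j'        ≡⟨ sym (block≡window-columnSum F p i j') ⟩
      block F p i j'                       ≡⟨ equal i j' i (suc j') hi (≤-trans (n≤1+n _) h) hi h ⟩
      block F p i (suc j')                 ≡⟨ block≡window-columnSum F p i (suc j') ⟩
      window p (columnSum F p i) (suc j')  ∎)
    n' j (+-monoˡ-< (n' * p) j<p)

  window-rowEnds : ∀ k → k ≤ p → ∀ i → i + p ≤ R → window p (rowEnds k) i ≡ block F p i 0
  window-rowEnds k k≤p i hi = begin
    window p (rowEnds k) i
      ≡⟨ sum<-distrib-+ p _ _ ⟩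
    sum< p (λ s → sum< k (F (i + s))) + sum< p (λ s → sum< (p ∸ k) (λ t → F (i + s) (C ∸ (p ∸ k) + t)))
      ≡⟨ cong₂ _+_ (sum<-comm p k _) (sum<-comm p (p ∸ k) _) ⟩
    sum< k (columnSum F p i) + sum< (p ∸ k) (λ t → columnSum F p i (C ∸ (p ∸ k) + t))
      ≡⟨ prefix+suffix≡sum< p k n' (columnSum F p i) k≤p (columnSum-periodic i hi) ⟩
    sum< p (columnSum F p i)
      ≡⟨ sym (block≡window-columnSum F p i 0) ⟩
    block F p i 0
      ∎

  rowEnds-periodic : ∀ k → k ≤ p → ∀ q → q * p < R → rowEnds k 0 ≡ rowEnds k (q * p)
  rowEnds-periodic k k≤p q = window-invariant⇒periodic R p (rowEnds k) (λ i h → begin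
    window p (rowEnds k) i        ≡⟨ window-rowEnds k k≤p i (≤-trans (n≤1+n _) h) ⟩
    block F p i 0                 ≡⟨ equal i 0 (suc i) 0 (≤-trans (n≤1+n _) h) (m≤m+n p _) h (m≤m+n p _) ⟩
    block F p (suc i) 0           ≡⟨ sym (window-rowEnds k k≤p (suc i) h) ⟩
    window p (rowEnds k) (suc i)  ∎) q 0

extend : {R C : ℕ} → Array R C → ℕ → ℕ → ℕ
extend {R} {C} A i j with i <? R | j <? C
... | yes i<R | yes j<C = A (fromℕ< i<R) (fromℕ< j<C)
... | _       | _       = 0

extend-toℕ : {R C : ℕ} (A : Array R C) (x : Fin R) (y : Fin C) → A x y ≡ extend A (toℕ x) (toℕ y)
extend-toℕ {R} {C} A x y with toℕ x <? R | toℕ y <? C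
... | yes x<R | yes y<C = sym (cong₂ A (fromℕ<-toℕ x x<R) (fromℕ<-toℕ y y<C))
... | no x≮R  | _       = ⊥-elim (x≮R (toℕ<n x))
... | yes _   | no y≮C  = ⊥-elim (y≮C (toℕ<n y))

extend-shift : {R C : ℕ} (A : Array R C) (x : Fin R) {len : ℕ} (s : ℕ) (le : s + len ≤ C) (t : Fin len) →
  A x (shift s le t) ≡ extend A (toℕ x) (s + toℕ t)
extend-shift A x s le t = trans (extend-toℕ A x _) (cong (extend A (toℕ x)) (toℕ-fromℕ< _))

blockSum≡block : {R C : ℕ} (A : Array R C) (p i j : ℕ) (hi : i + p ≤ R) (hj : j + p ≤ C) →
  blockSum A p i j hi hj ≡ block (extend A) p i j
blockSum≡block A p i j hi hj = sumTo≡sum< p _ _ (λ s → sumTo≡sum< p _ _ (λ t →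
  trans (extend-toℕ A _ _) (cong₂ (extend A) (toℕ-fromℕ< _) (toℕ-fromℕ< _))))

lemma4p2 : (m n k p : ℕ) → 1 ≤ m → 1 ≤ n → p ≥ 2 → 1 ≤ k → k < p →
    (A : Array (suc (m * p)) (n * p)) → AllBlocksEqual A p →
    (hk : k ≤ n * p) → (hpk : p ∸ k ≤ n * p) →
    rowPrefixSum (A zero) k hk + rowSuffixSum (A zero) (p ∸ k) hpk
    ≡ rowPrefixSum (A (fromℕ (m * p))) k hk + rowSuffixSum (A (fromℕ (m * p))) (p ∸ k) hpk
lemma4p2 m (suc n') k p _ (s≤s z≤n) _ _ k<p A equal hk hpk = begin
  ends zero                        ≡⟨ ends≡rowEnds zero ⟩
  rowEnds k 0                      ≡⟨ rowEnds-periodic k (<⇒≤ k<p) m (n<1+n (m * p)) ⟩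
  rowEnds k (m * p)                ≡⟨ cong (rowEnds k) (sym (toℕ-fromℕ (m * p))) ⟩
  rowEnds k (toℕ (fromℕ (m * p)))  ≡⟨ sym (ends≡rowEnds (fromℕ (m * p))) ⟩
  ends (fromℕ (m * p))             ∎
  where
  open EqualBlocks (extend A) p (suc (m * p)) n' (λ i j i' j' hi hj hi' hj' →
    trans (sym (blockSum≡block A p i j hi hj))
          (trans (equal i j i' j' hi hj hi' hj') (blockSum≡block A p i' j' hi' hj')))
  ends : Fin (suc (m * p)) → ℕ
  ends x = rowPrefixSum (A x) k hk + rowSuffixSum (A x) (p ∸ k) hpk
  ends≡rowEnds : ∀ x → ends x ≡ rowEnds k (toℕ x)
  ends≡rowEnds x = cong₂ _+_ (sumTo≡sum< k _ _ (extend-shift A x 0 hk))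
                             (sumTo≡sum< (p ∸ k) _ _ (extend-shift A x _ (≤-reflexive (m∸n+n≡m hpk))))
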